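{- Let $n\ge 2$ and $k\ge 0$ be integers and let $G$ be a simple graph of order $n$ with complement $\bar G$. The following are equivalent: (i) $\alpha_{k-reg}(G)+\alpha_{k-reg}(\bar G)=2n$; (ii) $\alpha_{k-reg}(G)\cdot\alpha_{k-reg}(\bar G)=n^2$; (iii) there is a nonnegative integer $h$ such that $G$ is $h$-regular and $k\ge\max\{h,\ n-1-h\}$.
   Context: All graphs are finite, simple and undirected. For a graph $G$ and an integer $i\ge 0$, $D_i(G)$ denotes the set of vertices of degree $i$ in $G$. For an integer $k\ge 0$, a set $S\subseteq V(G)$ is $k$-independent if the induced subgraph $G[S]$ has maximum degree at most $k$. A regular $k$-independent set is a $k$-independent set $S$ with $S\subseteq D_i(G)$ for some $i$. The regular $k$-independence number $\alpha_{k-reg}(G)$ is the maximum cardinality of a regular $k$-independent set of $G$. -}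

module Defs where

open import Data.Nat using (ℕ; _≤_)
open import Data.Bool using (Bool; true; false; not; _∧_)
open import Data.Fin using (Fin; _≟_)
open import Data.Fin.Subset using (Subset; _∈_; _∩_; ∣_∣)
open import Data.Vec using (tabulate)
open import Data.Product using (Σ; ∃; _×_)
open import Relation.Nullary.Decidable using (⌊_⌋)
open import Relation.Binary.PropositionalEquality using (_≡_)

record Graph (n : ℕ) : Set where
  field
    adj     : Fin n → Fin n → Bool
    adj-sym : ∀ i j → adj i j ≡ adj j i
    adj-irr : ∀ i → adj i i ≡ false
open Graph public

N : ∀ {n} → Graph n → Fin n → Subset n
N G i = tabulate (adj G i)

deg : ∀ {n} → Graph n → Fin n → ℕ
deg G i = ∣ N G i ∣

complement : ∀ {n} → Graph n → Graph n
complement {n} G = record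
  { adj    = λ i j → not (adj G i j) ∧ not ⌊ i ≟ j ⌋
  ; adj-sym = sy
  ; adj-irr = irr
  }
  where
  open import Relation.Binary.PropositionalEquality using (refl; cong₂; sym)
  open import Relation.Nullary using (yes; no)
  open import Data.Bool.Properties using (∧-zeroʳ)
  symDec : ∀ (i j : Fin n) → ⌊ i ≟ j ⌋ ≡ ⌊ j ≟ i ⌋
  symDec i j with i ≟ j | j ≟ i
  ... | yes _ | yes _ = refl
  ... | no _  | no _  = refl
  ... | yes p | no q  = Data.Empty.⊥-elim (q (sym p)) where import Data.Empty
  ... | no p  | yes q = Data.Empty.⊥-elim (p (sym q)) where import Data.Empty
  sy : ∀ i j → (not (adj G i j) ∧ not ⌊ i ≟ j ⌋) ≡ (not (adj G j i) ∧ not ⌊ j ≟ i ⌋)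
  sy i j = cong₂ (λ a b → not a ∧ not b) (adj-sym G i j) (symDec i j)
  irr : ∀ i → (not (adj G i i) ∧ not ⌊ i ≟ i ⌋) ≡ false
  irr i with i ≟ i
  ... | yes _ = ∧-zeroʳ (not (adj G i i))
  ... | no ¬p = Data.Empty.⊥-elim (¬p refl) where import Data.Empty

KIndependent : ∀ {n} → Graph n → ℕ → Subset n → Set
KIndependent G k S = ∀ v → v ∈ S → ∣ S ∩ N G v ∣ ≤ k

DegreeUniform : ∀ {n} → Graph n → Subset n → Set
DegreeUniform G S = ∃ λ i → ∀ v → v ∈ S → deg G v ≡ i

RegKIndependent : ∀ {n} → Graph n → ℕ → Subset n → Set
RegKIndependent G k S = KIndependent G k S × DegreeUniform G S

IsRegKIndNumber : ∀ {n} → Graph n → ℕ → ℕ → Set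
IsRegKIndNumber G k m =
  (Σ _ λ S → RegKIndependent G k S × ∣ S ∣ ≡ m)
  × (∀ S → RegKIndependent G k S → ∣ S ∣ ≤ m)

IsRegular : ∀ {n} → Graph n → ℕ → Set
IsRegular G h = ∀ v → deg G v ≡ h

-- Every α_{k-reg} is at most n, so (i) and (ii) both say that α_{k-reg}(G) and
-- α_{k-reg}(Ḡ) equal n, i.e. that the whole vertex set is regular k-independent
-- in G and in Ḡ. That happens exactly when G is h-regular with h ≤ k and Ḡ,
-- which is then (n − 1 − h)-regular, has n − 1 − h ≤ k.
module Submission where

open import Defs
open import Data.Bool using (Bool; true; false; not; _∧_)
open import Data.Bool.Properties using (∧-identityʳ)
open import Data.Empty using (⊥-elim)
open import Data.Fin using (Fin; zero; suc; _≟_)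
open import Data.Fin.Properties using (suc-injective)
open import Data.Fin.Subset using (Subset; ⊤; ∁; _∩_; ∣_∣)
open import Data.Fin.Subset.Properties using (∣p∣≤n; ∣p∣≡n⇒p≡⊤; ∣⊤∣≡n; ∣∁p∣≡n∸∣p∣; ∈⊤; ∩-identityˡ)
open import Data.Nat using (ℕ; _+_; _*_; _∸_; _≤_; _<_; _⊔_; s≤s)
open import Data.Nat.Properties
  using (≤-antisym; m≤n⇒m<n∨m≡n; <⇒≢; ≤-<-trans; *-monoʳ-≤; *-monoˡ-<; *-comm; +-comm;
         +-mono-<-≤; +-cancelˡ-≡; +-identityʳ; ∸-+-assoc; m+n∸n≡m; ⊔-lub; m⊔n≤o⇒m≤o; m⊔n≤o⇒n≤o)
open import Data.Product using (∃; _×_; _,_)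
open import Data.Product.Function.NonDependent.Propositional using (_×-⇔_)
open import Data.Sum using (inj₁; inj₂)
open import Data.Vec using (_∷_; tabulate)
open import Data.Vec.Properties using (tabulate-cong; tabulate-∘)
open import Function.Base using (_∘_)
open import Function.Bundles using (_⇔_; mk⇔)
import Function.Properties.Equivalence as ⇔
open import Relation.Nullary.Decidable using (⌊_⌋; ⌊⌋-map′)
open import Relation.Binary.PropositionalEquality
  using (_≡_; refl; sym; trans; cong; subst; module ≡-Reasoning)

∣∷∣-+1-cong : ∀ {n} x (p q : Subset n) → ∣ p ∣ + 1 ≡ ∣ q ∣ → ∣ x ∷ p ∣ + 1 ≡ ∣ x ∷ q ∣
∣∷∣-+1-cong true  _ _ e = cong ℕ.suc e
∣∷∣-+1-cong false _ _ e = e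

∣tabulate∣-remove : ∀ {n} (g : Fin n → Bool) (v : Fin n) → g v ≡ true →
  ∣ tabulate (λ j → g j ∧ not ⌊ v ≟ j ⌋) ∣ + 1 ≡ ∣ tabulate g ∣
∣tabulate∣-remove g zero gv rewrite gv =
  trans (+-comm _ 1) (cong (λ p → 1 + ∣ p ∣) (tabulate-cong (λ j → ∧-identityʳ (g (suc j)))))
∣tabulate∣-remove g (suc v) gv rewrite ∧-identityʳ (g zero) =
  ∣∷∣-+1-cong (g zero) (tabulate (λ j → g (suc j) ∧ not ⌊ suc v ≟ suc j ⌋)) (tabulate (g ∘ suc))
    (trans (cong (λ p → ∣ p ∣ + 1) (tabulate-cong shift)) (∣tabulate∣-remove (g ∘ suc) v gv))
  where
  shift : ∀ j → g (suc j) ∧ not ⌊ suc v ≟ suc j ⌋ ≡ g (suc j) ∧ not ⌊ v ≟ j ⌋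
  shift j = cong (λ b → g (suc j) ∧ not b) (⌊⌋-map′ (cong suc) suc-injective (v ≟ j))

-- In Ḡ, v is adjacent to the complement of N G v minus v itself, and v lies in that
-- complement by irreflexivity.
deg-complement : ∀ {n} (G : Graph n) v → deg (complement G) v ≡ n ∸ 1 ∸ deg G v
deg-complement {n} G v = begin
  deg (complement G) v                ≡⟨ sym (m+n∸n≡m _ 1) ⟩
  deg (complement G) v + 1 ∸ 1        ≡⟨ cong (_∸ 1) (∣tabulate∣-remove (not ∘ adj G v) v (cong not (adj-irr G v))) ⟩
  ∣ tabulate (not ∘ adj G v) ∣ ∸ 1    ≡⟨ cong (λ p → ∣ p ∣ ∸ 1) (tabulate-∘ not (adj G v)) ⟩
  ∣ ∁ (N G v) ∣ ∸ 1                   ≡⟨ cong (_∸ 1) (∣∁p∣≡n∸∣p∣ (N G v)) ⟩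
  n ∸ deg G v ∸ 1                     ≡⟨ ∸-+-assoc n (deg G v) 1 ⟩
  n ∸ (deg G v + 1)                   ≡⟨ cong (n ∸_) (+-comm (deg G v) 1) ⟩
  n ∸ (1 + deg G v)                   ≡⟨ ∸-+-assoc n 1 (deg G v) ⟨
  n ∸ 1 ∸ deg G v                     ∎
  where open ≡-Reasoning

complement-regular : ∀ {n} (G : Graph n) {h} → IsRegular G h → IsRegular (complement G) (n ∸ 1 ∸ h)
complement-regular {n} G r v = trans (deg-complement G v) (cong (n ∸ 1 ∸_) (r v))

regKIndependent-⊤⇔regular : ∀ {n} (H : Graph n) k → Fin n →
  RegKIndependent H k ⊤ ⇔ ∃ λ h → IsRegular H h × h ≤ k
regKIndependent-⊤⇔regular H k v₀ = mk⇔
  (λ (indep , h , uniform) → h , (λ v → uniform v ∈⊤) , subst (_≤ k) (uniform v₀ ∈⊤) (deg≤ indep v₀))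
  (λ (h , r , h≤k) → (λ v _ → subst (_≤ k) (sym (∣⊤∩N∣≡deg v)) (subst (_≤ k) (sym (r v)) h≤k))
                   , h , λ v _ → r v)
  where
  ∣⊤∩N∣≡deg : ∀ v → ∣ ⊤ ∩ N H v ∣ ≡ deg H v
  ∣⊤∩N∣≡deg v = cong ∣_∣ (∩-identityˡ (N H v))
  deg≤ : KIndependent H k ⊤ → ∀ v → deg H v ≤ k
  deg≤ indep v = subst (_≤ k) (∣⊤∩N∣≡deg v) (indep v ∈⊤)

regKIndNumber≤n : ∀ {n} (H : Graph n) {k m} → IsRegKIndNumber H k m → m ≤ n
regKIndNumber≤n _ ((S , _ , ∣S∣≡m) , _) = subst (_≤ _) ∣S∣≡m (∣p∣≤n S)

regKIndNumber≡n⇔ : ∀ {n} (H : Graph n) {k m} → IsRegKIndNumber H k m → (m ≡ n ⇔ RegKIndependent H k ⊤)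
regKIndNumber≡n⇔ {n} H {k} {m} α@((S , S-reg , ∣S∣≡m) , maximal) = mk⇔
  (λ m≡n → subst (RegKIndependent H k) (∣p∣≡n⇒p≡⊤ (trans ∣S∣≡m m≡n)) S-reg)
  (λ ⊤-reg → ≤-antisym (regKIndNumber≤n H α) (subst (_≤ m) (∣⊤∣≡n n) (maximal ⊤ ⊤-reg)))

+-≡-at-max : ∀ {a b n} → a ≤ n → b ≤ n → (a + b ≡ n + n ⇔ (a ≡ n × b ≡ n))
+-≡-at-max {a} {b} {n} a≤n b≤n = mk⇔ to λ { (refl , refl) → refl }
  where
  to : a + b ≡ n + n → a ≡ n × b ≡ n
  to e with m≤n⇒m<n∨m≡n a≤n
  ... | inj₁ a<n  = ⊥-elim (<⇒≢ (+-mono-<-≤ a<n b≤n) e)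
  ... | inj₂ refl = refl , +-cancelˡ-≡ n b n e

*-<-≤ : ∀ {a b n} → a < n → b ≤ n → a * b < n * n
*-<-≤ {a} {n = n@(ℕ.suc _)} a<n b≤n = ≤-<-trans (*-monoʳ-≤ a b≤n) (*-monoˡ-< n a<n)

*-≡-at-max : ∀ {a b n} → a ≤ n → b ≤ n → (a * b ≡ n * n ⇔ (a ≡ n × b ≡ n))
*-≡-at-max {a} {b} {n} a≤n b≤n = mk⇔ to λ { (refl , refl) → refl }
  where
  to : a * b ≡ n * n → a ≡ n × b ≡ n
  to e with m≤n⇒m<n∨m≡n a≤n | m≤n⇒m<n∨m≡n b≤n
  ... | inj₁ a<n  | _         = ⊥-elim (<⇒≢ (*-<-≤ a<n b≤n) e)
  ... | _         | inj₁ b<n  = ⊥-elim (<⇒≢ (*-<-≤ b<n a≤n) (trans (*-comm b a) e))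
  ... | inj₂ a≡n  | inj₂ b≡n  = a≡n , b≡n

⊤-regKIndependent-both⇔ : ∀ {n} (G : Graph n) k → Fin n →
  (RegKIndependent G k ⊤ × RegKIndependent (complement G) k ⊤)
    ⇔ (∃ λ h → IsRegular G h × (h ⊔ (n ∸ 1 ∸ h)) ≤ k)
⊤-regKIndependent-both⇔ {n} G k v =
  ⇔.trans (regKIndependent-⊤⇔regular G k v ×-⇔ regKIndependent-⊤⇔regular (complement G) k v)
          (mk⇔ to from)
  where
  to : (∃ λ h → IsRegular G h × h ≤ k) × (∃ λ h̄ → IsRegular (complement G) h̄ × h̄ ≤ k)
     → ∃ λ h → IsRegular G h × (h ⊔ (n ∸ 1 ∸ h)) ≤ k
  to ((h , r , h≤k) , (h̄ , r̄ , h̄≤k)) =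
    h , r , ⊔-lub h≤k (subst (_≤ k) (trans (sym (r̄ v)) (complement-regular G r v)) h̄≤k)
  from : (∃ λ h → IsRegular G h × (h ⊔ (n ∸ 1 ∸ h)) ≤ k)
       → (∃ λ h → IsRegular G h × h ≤ k) × (∃ λ h̄ → IsRegular (complement G) h̄ × h̄ ≤ k)
  from (h , r , ⊔≤k) = (h , r , m⊔n≤o⇒m≤o h _ ⊔≤k)
                     , (n ∸ 1 ∸ h , complement-regular G r , m⊔n≤o⇒n≤o h _ ⊔≤k)

proposition6p2 : (n k : ℕ) → 2 ≤ n → (G : Graph n) → (a b : ℕ)
    → IsRegKIndNumber G k a → IsRegKIndNumber (complement G) k b
    → ((a + b ≡ 2 * n) ⇔ (a * b ≡ n * n))
    × ((a * b ≡ n * n) ⇔ (∃ λ h → IsRegular G h × (h ⊔ (n ∸ 1 ∸ h)) ≤ k))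
proposition6p2 n k (s≤s _) G a b α β =
  ⇔.trans sum⇔both (⇔.sym product⇔both) ,
  ⇔.trans product⇔both
    (⇔.trans (regKIndNumber≡n⇔ G α ×-⇔ regKIndNumber≡n⇔ (complement G) β) (⊤-regKIndependent-both⇔ G k zero))
  where
  a≤n : a ≤ n
  a≤n = regKIndNumber≤n G α
  b≤n : b ≤ n
  b≤n = regKIndNumber≤n (complement G) β
  sum⇔both : (a + b ≡ 2 * n) ⇔ (a ≡ n × b ≡ n)
  sum⇔both = subst (λ s → (a + b ≡ s) ⇔ (a ≡ n × b ≡ n))
                   (sym (cong (n +_) (+-identityʳ n))) (+-≡-at-max a≤n b≤n)
  product⇔both : (a * b ≡ n * n) ⇔ (a ≡ n × b ≡ n)
  product⇔both = *-≡-at-max a≤n b≤n
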